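{- Assume that every finite simple graph $G$ satisfies $q_{list}(G)\le \Delta(G)+1$, where $\Delta(G)$ is the maximum degree of $G$. Let $H=(V,E)$ be a finite linear hypergraph with $n$ vertices, and let $H_3=(V,E_3)$ where $E_3$ is the set of edges of $H$ of rank at least $3$. If $H_3$ is regular (every vertex of $V$ lies in the same number $d$ of edges of $E_3$), then every edge coloring of $H_3$ with colors from a set of $n$ colors can be extended to an edge coloring of $H$ using colors from the same set of $n$ colors.
   Context: A hypergraph $H=(V,E)$ is a finite set $V$ with a set $E$ of subsets of $V$ (edges); the rank of an edge is its cardinality, and $H$ is linear if any two distinct edges share at most one vertex. An edge coloring is a map $\gamma$ from the edges to a set of colors such that $\gamma(e)=\gamma(f)$ for distinct edges $e,f$ only if $e\cap f=\emptyset$. For a graph $G$, $q_{list}(G)$ is the least $k$ such that for every assignment of a list of $k$ colors to each edge of $G$, there is a proper edge coloring of $G$ in which each edge gets a color from its own list. -}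

module Defs where

open import Data.Nat using (ℕ; _≤_; _≤?_; _⊔_)
open import Data.Fin using (Fin)
open import Data.Fin.Subset using (Subset; _∈_; _∩_; ∣_∣; Empty)
open import Data.Fin.Subset.Properties using (_∈?_)
open import Data.List using (List; length; filter; foldr; map; allFin)
open import Data.List.Membership.Propositional renaming (_∈_ to _∈ₗ_)
open import Data.List.Relation.Unary.Unique.Propositional using (Unique)
open import Data.Product using (_×_; Σ; ∃; _,_)
open import Relation.Nullary using (¬_)
open import Relation.Nullary.Decidable using (_×-dec_)
open import Relation.Binary.PropositionalEquality using (_≡_; _≢_)
open import Function.Definitions using (Injective)

-- A finite hypergraph on the vertex set Fin n: its edges are indexed by
-- Fin m, each edge is a subset of the vertices, and distinct indices give
-- distinct edges (E is a *set* of subsets).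
record Hypergraph (n : ℕ) : Set where
  field
    m        : ℕ
    edge     : Fin m → Subset n
    distinct : Injective _≡_ _≡_ edge
open Hypergraph public

rank : ∀ {n} (H : Hypergraph n) → Fin (m H) → ℕ
rank H i = ∣ edge H i ∣

Linear : ∀ {n} → Hypergraph n → Set
Linear H = ∀ i j → i ≢ j → ∣ edge H i ∩ edge H j ∣ ≤ 1

NonemptyEdges : ∀ {n} → Hypergraph n → Set
NonemptyEdges H = ∀ i → 1 ≤ rank H i

Disjoint : ∀ {n} → Subset n → Subset n → Set
Disjoint p q = Empty (p ∩ q)

Big : ∀ {n} (H : Hypergraph n) → Fin (m H) → Set
Big H i = 3 ≤ rank H i

deg₃ : ∀ {n} (H : Hypergraph n) → Fin n → ℕ
deg₃ H v = length (filter (λ i → (3 ≤? rank H i) ×-dec (v ∈? edge H i)) (allFin (m H)))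

Regular₃ : ∀ {n} → Hypergraph n → Set
Regular₃ {n} H = ∃ λ d → ∀ (v : Fin n) → deg₃ H v ≡ d

IsEdgeColoring₃ : ∀ {n} (H : Hypergraph n) {C : Set} →
                  ((i : Fin (m H)) → Big H i → C) → Set
IsEdgeColoring₃ H γ =
  ∀ i j (bi : Big H i) (bj : Big H j) → i ≢ j → γ i bi ≡ γ j bj →
  Disjoint (edge H i) (edge H j)

IsEdgeColoring : ∀ {n} (H : Hypergraph n) {C : Set} → (Fin (m H) → C) → Set
IsEdgeColoring H γ =
  ∀ i j → i ≢ j → γ i ≡ γ j → Disjoint (edge H i) (edge H j)

SimpleGraph : ℕ → Set
SimpleGraph N = Σ (Hypergraph N) λ G → ∀ i → rank G i ≡ 2

degree : ∀ {N} → Hypergraph N → Fin N → ℕ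
degree G v = length (filter (λ i → v ∈? edge G i) (allFin (m G)))

-- maximum degree Δ(G) (0 for the graph with no vertices)
maxDegree : ∀ {N} → Hypergraph N → ℕ
maxDegree {N} G = foldr _⊔_ 0 (map (degree G) (allFin N))

EdgeChoosable : ∀ {N} → Hypergraph N → ℕ → Set
EdgeChoosable G k =
  (L : Fin (m G) → List ℕ) →
  (∀ i → length (L i) ≡ k) → (∀ i → Unique (L i)) →
  Σ (Fin (m G) → ℕ) λ c → (∀ i → c i ∈ₗ L i) × IsEdgeColoring G c

-- q_list(G) ≤ k  (q_list(G) is the least k' with EdgeChoosable G k')
qlist≤ : ∀ {N} → Hypergraph N → ℕ → Set
qlist≤ G k = ∃ λ k' → k' ≤ k × EdgeChoosable G k'

-- In a linear hypergraph the sets e - v, for the edges e through a vertex v, are pairwise disjoint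
-- subsets of V - v, so the sum of (rank e - 1) over these edges is less than n. When H₃ is
-- d-regular, a vertex therefore lies in at most n - 1 - 2d edges of rank 2: the graph G of rank-2
-- edges has Δ(G) ≤ n - 1 - 2d. A rank-2 edge meets at most 2d edges of E₃ (d at each end), so at
-- least n - 2d ≥ Δ(G) + 1 colors are free for it, and the list-coloring hypothesis colors G from
-- these lists. Finally, an edge {v} of rank 1 meets fewer than n edges of rank ≥ 2 (each has a
-- further vertex of its own), so some color is still free at v; distinct rank-1 edges are disjoint.
module Submission where

open import Data.Bool using (true; false)
open import Data.Empty using (⊥-elim)
open import Data.Fin using (Fin; zero; suc; toℕ; _≟_)
open import Data.Fin.Properties using (toℕ-injective; injective⇒≤; all?; ¬∀⟶∃¬)
open import Data.Fin.Subset using (Subset; _∈_; _∉_; _∩_; _∪_; _-_; ⋃; ⁅_⁆; ⊤; Nonempty; Empty; ∣_∣)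
open import Data.Fin.Subset.Properties
open import Data.List using (List; []; _∷_; _++_; length; filter; map; lookup; take; allFin)
open import Data.List.Properties
  using (filter-≐; filter-accept; filter-reject; foldr-preservesᵇ; length-map; length-++; length-take;
         take++drop≡id; map-tabulate; tabulate-lookup)
open import Data.List.Membership.Propositional using () renaming (_∈_ to _∈ₗ_; _∉_ to _∉ₗ_)
open import Data.List.Membership.Propositional.Properties
  using (∈-lookup; ∈-map⁺; ∈-map⁻; ∈-filter⁺; ∈-filter⁻; ∈-allFin; ∈-++⁺ˡ; ∈-++⁺ʳ)
open import Data.List.Membership.Setoid.Properties using (index-injective)
open import Data.List.Relation.Unary.All as All using (All; _∷_)
import Data.List.Relation.Unary.All.Properties as All
open import Data.List.Relation.Unary.AllPairs using (_∷_)
import Data.List.Relation.Unary.Any as Any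
open import Data.List.Relation.Unary.Any.Properties using (lookup-index)
open import Data.List.Relation.Unary.Unique.Propositional using (Unique)
open import Data.List.Relation.Unary.Unique.Propositional.Properties using (filter⁺; allFin⁺; take⁺; map⁺)
open import Data.Nat using (ℕ; suc; pred; _+_; _*_; _∸_; _≤_; _<_; _≤?_; z≤n; s≤s)
import Data.Nat as ℕ
open import Data.Nat.ListAction using (sum)
open import Data.Nat.Properties
  using (+-suc; +-assoc; +-comm; +-identityʳ; *-suc; +-mono-≤; +-monoˡ-≤; +-cancelʳ-≤; ⊔-lub;
         ≤-trans; ≤-reflexive; ≤-pred; ≤-irrelevant; pred-mono-≤; suc-injective; n≤1+n; m≤n+m; 1+n≰n;
         ≰⇒>; <⇒≱; ≤∧≢⇒<; m≤o∸n⇒m+n≤o; m+n≤o⇒m≤o∸n; m≤n⇒m⊓n≡m; module ≤-Reasoning)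
open import Data.Product using (Σ; ∃; ∃₂; _×_; _,_; proj₁; proj₂; swap)
open import Data.Sum using (_⊎_; inj₁; inj₂)
open import Data.Vec using ([]; _∷_; here; there)
open import Function using (_∘_; id; case_of_)
open import Level using (Level; 0ℓ)
open import Relation.Binary.PropositionalEquality
  using (_≡_; _≢_; refl; sym; trans; cong; cong₂; subst; subst₂; setoid; module ≡-Reasoning)
open import Relation.Nullary using (¬_; Dec; does; yes; no; contradiction)
open import Relation.Nullary.Decidable using (_×-dec_; ¬?)
open import Relation.Unary using (Pred; Decidable)

open import Defs

-- Subsets of Fin n

x∉p-x : ∀ {n} {x : Fin n} (p : Subset n) → x ∉ p - x
x∉p-x {x = zero}  (_ ∷ p) ()
x∉p-x {x = suc x} (_ ∷ p) (there x∈p-x) = x∉p-x p x∈p-x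

∣p∣≡1+∣p-x∣ : ∀ {n} {x : Fin n} {p : Subset n} → x ∈ p → ∣ p ∣ ≡ suc ∣ p - x ∣
∣p∣≡1+∣p-x∣ {x = zero}  {true ∷ p}  here      = cong (suc ∘ ∣_∣) (sym (p─⊥≡p p))
∣p∣≡1+∣p-x∣ {x = suc x} {true ∷ p}  (there i) = cong suc (∣p∣≡1+∣p-x∣ i)
∣p∣≡1+∣p-x∣ {x = suc x} {false ∷ p} (there i) = ∣p∣≡1+∣p-x∣ i

∣p∪q∣≡∣p∣+∣q∣ : ∀ {n} (p q : Subset n) → Empty (p ∩ q) → ∣ p ∪ q ∣ ≡ ∣ p ∣ + ∣ q ∣
∣p∪q∣≡∣p∣+∣q∣ []          []          _    = refl
∣p∪q∣≡∣p∣+∣q∣ (true ∷ p)  (true ∷ q)  p∩q=∅ = ⊥-elim (p∩q=∅ (zero , here))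
∣p∪q∣≡∣p∣+∣q∣ (true ∷ p)  (false ∷ q) p∩q=∅ = cong suc (∣p∪q∣≡∣p∣+∣q∣ p q (drop-∷-Empty p∩q=∅))
∣p∪q∣≡∣p∣+∣q∣ (false ∷ p) (true ∷ q)  p∩q=∅ =
  trans (cong suc (∣p∪q∣≡∣p∣+∣q∣ p q (drop-∷-Empty p∩q=∅))) (sym (+-suc ∣ p ∣ ∣ q ∣))
∣p∪q∣≡∣p∣+∣q∣ (false ∷ p) (false ∷ q) p∩q=∅ = ∣p∪q∣≡∣p∣+∣q∣ p q (drop-∷-Empty p∩q=∅)

1≤∣p∣⇒Nonempty : ∀ {n} {p : Subset n} → 1 ≤ ∣ p ∣ → Nonempty p
1≤∣p∣⇒Nonempty {n} {p} 1≤∣p∣ with nonempty? p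
... | yes p≠∅ = p≠∅
... | no  p=∅ = contradiction (≤-trans 1≤∣p∣ (≤-reflexive (trans (cong ∣_∣ (Empty-unique p=∅)) (∣⊥∣≡0 n)))) λ ()

∣p∣≤1⇒x≡y : ∀ {n} {p : Subset n} {x y} → ∣ p ∣ ≤ 1 → x ∈ p → y ∈ p → x ≡ y
∣p∣≤1⇒x≡y {x = x} {y} ∣p∣≤1 x∈p y∈p with x ≟ y
... | yes x≡y = x≡y
... | no  x≢y = contradiction (≤-trans (x∈p⇒∣p-x∣<∣p∣ y∈p-x) (≤-pred (≤-trans (x∈p⇒∣p-x∣<∣p∣ x∈p) ∣p∣≤1))) λ ()
  where y∈p-x = x∈p∧x≢y⇒x∈p-y y∈p (x≢y ∘ sym)

∣p∣≤1⇒p≡⁅x⁆ : ∀ {n} {p : Subset n} {x} → ∣ p ∣ ≤ 1 → x ∈ p → p ≡ ⁅ x ⁆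
∣p∣≤1⇒p≡⁅x⁆ {x = x} ∣p∣≤1 x∈p = ⊆-antisym
  (λ y∈p → subst (_∈ ⁅ x ⁆) (∣p∣≤1⇒x≡y ∣p∣≤1 x∈p y∈p) (x∈⁅x⁆ x))
  (λ y∈⁅x⁆ → subst (_∈ _) (sym (x∈⁅y⁆⇒x≡y x y∈⁅x⁆)) x∈p)

meet-sym : ∀ {n} {p q : Subset n} → Nonempty (p ∩ q) → Nonempty (q ∩ p)
meet-sym {p = p} {q} = subst Nonempty (∩-comm p q)

∣p∣≡2⇒⊆pair : ∀ {n} {p : Subset n} → ∣ p ∣ ≡ 2 → ∃₂ λ u v → ∀ {w} → w ∈ p → w ≡ u ⊎ w ≡ v
∣p∣≡2⇒⊆pair {p = p} ∣p∣≡2 =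
  let u , u∈p   = 1≤∣p∣⇒Nonempty {p = p} (≤-trans (s≤s z≤n) (≤-reflexive (sym ∣p∣≡2)))
      ∣p-u∣≡1   = suc-injective (trans (sym (∣p∣≡1+∣p-x∣ {p = p} u∈p)) ∣p∣≡2)
      v , v∈p-u = 1≤∣p∣⇒Nonempty {p = p - u} (≤-reflexive (sym ∣p-u∣≡1))
  in u , v , λ {w} w∈p → case w ≟ u of λ where
       (yes w≡u) → inj₁ w≡u
       (no  w≢u) → inj₂ (∣p∣≤1⇒x≡y {p = p - u} (≤-reflexive ∣p-u∣≡1) (x∈p∧x≢y⇒x∈p-y w∈p w≢u) v∈p-u)

-- Lists

private variable
  a b p q : Level
  A B : Set a

module _ {P : Pred A p} {Q : Pred A q} (P? : Decidable P) (Q? : Decidable Q) where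

  filter-×-dec : ∀ xs → filter (λ x → P? x ×-dec Q? x) xs ≡ filter P? (filter Q? xs)
  filter-×-dec []       = refl
  filter-×-dec (x ∷ xs) = by-cases (P? x) (Q? x)
    where
    PQ? = λ x → P? x ×-dec Q? x
    by-cases : Dec (P x) → Dec (Q x) → filter PQ? (x ∷ xs) ≡ filter P? (filter Q? (x ∷ xs))
    by-cases (yes px) (yes qx) = begin
      filter PQ? (x ∷ xs)            ≡⟨ filter-accept PQ? (px , qx) ⟩
      x ∷ filter PQ? xs              ≡⟨ cong (x ∷_) (filter-×-dec xs) ⟩
      x ∷ filter P? (filter Q? xs)   ≡⟨ filter-accept P? px ⟨
      filter P? (x ∷ filter Q? xs)   ≡⟨ cong (filter P?) (filter-accept Q? qx) ⟨
      filter P? (filter Q? (x ∷ xs)) ∎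
      where open ≡-Reasoning
    by-cases (no ¬px) (yes qx) = begin
      filter PQ? (x ∷ xs)            ≡⟨ filter-reject PQ? (¬px ∘ proj₁) ⟩
      filter PQ? xs                  ≡⟨ filter-×-dec xs ⟩
      filter P? (filter Q? xs)       ≡⟨ filter-reject P? ¬px ⟨
      filter P? (x ∷ filter Q? xs)   ≡⟨ cong (filter P?) (filter-accept Q? qx) ⟨
      filter P? (filter Q? (x ∷ xs)) ∎
      where open ≡-Reasoning
    by-cases _ (no ¬qx) = begin
      filter PQ? (x ∷ xs)            ≡⟨ filter-reject PQ? (¬qx ∘ proj₂) ⟩
      filter PQ? xs                  ≡⟨ filter-×-dec xs ⟩
      filter P? (filter Q? xs)       ≡⟨ cong (filter P?) (filter-reject Q? ¬qx) ⟨
      filter P? (filter Q? (x ∷ xs)) ∎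
      where open ≡-Reasoning

filter-comm : {P : Pred A p} {Q : Pred A q} (P? : Decidable P) (Q? : Decidable Q) →
              ∀ xs → filter P? (filter Q? xs) ≡ filter Q? (filter P? xs)
filter-comm P? Q? xs = begin
  filter P? (filter Q? xs)          ≡⟨ filter-×-dec P? Q? xs ⟨
  filter (λ x → P? x ×-dec Q? x) xs ≡⟨ filter-≐ _ _ (swap , swap) xs ⟩
  filter (λ x → Q? x ×-dec P? x) xs ≡⟨ filter-×-dec Q? P? xs ⟩
  filter Q? (filter P? xs)          ∎
  where open ≡-Reasoning

filter-map : {P : Pred B p} (P? : Decidable P) (f : A → B) →
             ∀ xs → filter P? (map f xs) ≡ map f (filter (P? ∘ f) xs)
filter-map P? f []       = refl
filter-map P? f (x ∷ xs) with does (P? (f x))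
... | true  = cong (f x ∷_) (filter-map P? f xs)
... | false = filter-map P? f xs

module _ {P : Pred A p} (P? : Decidable P) {w : A → ℕ} (1≤w : ∀ {x} → P x → 1 ≤ w x) where

  length-filter≤sum : ∀ xs → length (filter P? xs) ≤ sum (map w xs)
  length-filter≤sum []       = z≤n
  length-filter≤sum (x ∷ xs) with P? x
  ... | yes px = +-mono-≤ (1≤w px) (length-filter≤sum xs)
  ... | no  _  = ≤-trans (length-filter≤sum xs) (m≤n+m _ (w x))

module _ {P : Pred A p} {Q : Pred A q} (P? : Decidable P) (Q? : Decidable Q) {w : A → ℕ}
         (2≤w : ∀ {x} → P x → 2 ≤ w x) (1≤w : ∀ {x} → Q x → 1 ≤ w x) (P⇒¬Q : ∀ {x} → P x → ¬ Q x) where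

  2*length-filter+length-filter≤sum : ∀ xs →
    2 * length (filter P? xs) + length (filter Q? xs) ≤ sum (map w xs)
  2*length-filter+length-filter≤sum []       = z≤n
  2*length-filter+length-filter≤sum (x ∷ xs) with P? x | Q? x
  ... | yes px | yes qx = contradiction qx (P⇒¬Q px)
  ... | yes px | no  _  = begin
    2 * suc c + d        ≡⟨ cong (_+ d) (*-suc 2 c) ⟩
    2 + 2 * c + d        ≡⟨ +-assoc 2 (2 * c) d ⟩
    2 + (2 * c + d)      ≤⟨ +-mono-≤ (2≤w px) (2*length-filter+length-filter≤sum xs) ⟩
    w x + sum (map w xs) ∎
    where
    open ≤-Reasoning
    c = length (filter P? xs)
    d = length (filter Q? xs)
  ... | no  _  | yes qx = begin
    2 * c + suc d        ≡⟨ +-suc (2 * c) d ⟩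
    suc (2 * c + d)      ≤⟨ +-mono-≤ (1≤w qx) (2*length-filter+length-filter≤sum xs) ⟩
    w x + sum (map w xs) ∎
    where
    open ≤-Reasoning
    c = length (filter P? xs)
    d = length (filter Q? xs)
  ... | no  _  | no  _  = ≤-trans (2*length-filter+length-filter≤sum xs) (m≤n+m _ (w x))

lookup-injective : ∀ {xs : List A} → Unique xs → ∀ i j → lookup xs i ≡ lookup xs j → i ≡ j
lookup-injective {xs = _ ∷ _} _          zero    zero    _  = refl
lookup-injective {xs = _ ∷ _} (x∉xs ∷ _) zero    (suc j) eq = contradiction eq (All.lookup x∉xs (∈-lookup j))
lookup-injective {xs = _ ∷ _} (x∉xs ∷ _) (suc i) zero    eq = contradiction (sym eq) (All.lookup x∉xs (∈-lookup i))
lookup-injective {xs = _ ∷ _} (_ ∷ uniq) (suc i) (suc j) eq = cong suc (lookup-injective uniq i j eq)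

∈-take⁻ : ∀ {x : A} k xs → x ∈ₗ take k xs → x ∈ₗ xs
∈-take⁻ k xs x∈ = subst (_ ∈ₗ_) (take++drop≡id k xs) (∈-++⁺ˡ x∈)

complete⇒n≤length : ∀ {n} (xs : List (Fin n)) → (∀ c → c ∈ₗ xs) → n ≤ length xs
complete⇒n≤length xs ∈xs =
  injective⇒≤ {f = λ c → Any.index (∈xs c)} λ {c} {c′} → index-injective (setoid _) (∈xs c) (∈xs c′)

module _ {n : ℕ} where
  open import Data.List.Membership.DecPropositional (_≟_ {n}) using () renaming (_∈?_ to _∈ₗ?_)

  avoiding : List (Fin n) → List (Fin n)
  avoiding B = filter (λ c → ¬? (c ∈ₗ? B)) (allFin n)

  n≤length-avoiding+length : ∀ B → n ≤ length (avoiding B) + length B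
  n≤length-avoiding+length B = subst (n ≤_) (length-++ (avoiding B)) (complete⇒n≤length _ ∈avoiding++B)
    where
    ∈avoiding++B : ∀ c → c ∈ₗ avoiding B ++ B
    ∈avoiding++B c with c ∈ₗ? B
    ... | yes c∈B = ∈-++⁺ʳ (avoiding B) c∈B
    ... | no  c∉B = ∈-++⁺ˡ (∈-filter⁺ (λ c → ¬? (c ∈ₗ? B)) (∈-allFin c) c∉B)

  ∈-avoiding⇒∉ : ∀ {B c} → c ∈ₗ avoiding B → c ∉ₗ B
  ∈-avoiding⇒∉ {B} = proj₂ ∘ ∈-filter⁻ (λ c → ¬? (c ∈ₗ? B)) {xs = allFin n}

  avoiding-unique : ∀ B → Unique (avoiding B)
  avoiding-unique B = filter⁺ _ (allFin⁺ n)

  fresh : ∀ B → length B < n → ∃ λ c → c ∉ₗ B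
  fresh B |B|<n with all? (_∈ₗ? B)
  ... | yes all∈B  = contradiction (complete⇒n≤length B all∈B) (<⇒≱ |B|<n)
  ... | no  ¬all∈B = ¬∀⟶∃¬ n _ (_∈ₗ? B) ¬all∈B

-- Degrees in linear hypergraphs

module _ {n} (H : Hypergraph n) where

  big? : Decidable (Big H)
  big? i = 3 ≤? rank H i

  2≤rank? : Decidable (λ i → 2 ≤ rank H i)
  2≤rank? i = 2 ≤? rank H i

  rank≡2? : Decidable (λ i → rank H i ≡ 2)
  rank≡2? i = rank H i ℕ.≟ 2

  incident? : ∀ v → Decidable (λ i → v ∈ edge H i)
  incident? v i = v ∈? edge H i

  edgesAt : Fin n → List (Fin (m H))
  edgesAt v = filter (incident? v) (allFin (m H))

  edgesAt-unique : ∀ v → Unique (edgesAt v)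
  edgesAt-unique v = filter⁺ _ (allFin⁺ (m H))

  ∈-edgesAt⁺ : ∀ {v i} → v ∈ edge H i → i ∈ₗ edgesAt v
  ∈-edgesAt⁺ {v} {i} = ∈-filter⁺ (incident? v) (∈-allFin i)

  deg₃≡length-filter-big : ∀ v → deg₃ H v ≡ length (filter big? (edgesAt v))
  deg₃≡length-filter-big v = cong length (filter-×-dec big? (incident? v) (allFin (m H)))

  link : Fin n → List (Fin (m H)) → Subset n
  link v is = ⋃ (map (λ i → edge H i - v) is)

  ∈-link⁻ : ∀ {v w} is → w ∈ link v is → ∃ λ i → i ∈ₗ is × w ∈ edge H i - v
  ∈-link⁻ []       w∈link = contradiction w∈link ∉⊥
  ∈-link⁻ (i ∷ is) w∈link with x∈p∪q⁻ (edge H i - _) (link _ is) w∈link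
  ... | inj₁ w∈i-v  = i , Any.here refl , w∈i-v
  ... | inj₂ w∈link′ = let i′ , i′∈is , w∈i′-v = ∈-link⁻ is w∈link′ in i′ , Any.there i′∈is , w∈i′-v

  v∉link : ∀ {v} is → v ∉ link v is
  v∉link is v∈link = let i , _ , v∈i-v = ∈-link⁻ is v∈link in x∉p-x (edge H i) v∈i-v

  ∣link∣≡sum-pred-rank : Linear H → ∀ {v} is → Unique is → All (λ i → v ∈ edge H i) is →
                         ∣ link v is ∣ ≡ sum (map (pred ∘ rank H) is)
  ∣link∣≡sum-pred-rank lin []       _                  _            = ∣⊥∣≡0 n
  ∣link∣≡sum-pred-rank lin {v} (i ∷ is) (i∉is ∷ is-unique) (v∈i ∷ v∈is) = begin
    ∣ (edge H i - v) ∪ link v is ∣   ≡⟨ ∣p∪q∣≡∣p∣+∣q∣ _ _ disjoint ⟩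
    ∣ edge H i - v ∣ + ∣ link v is ∣ ≡⟨ cong₂ _+_ (cong pred (sym (∣p∣≡1+∣p-x∣ v∈i)))
                                                  (∣link∣≡sum-pred-rank lin is is-unique v∈is) ⟩
    pred (rank H i) + sum (map (pred ∘ rank H) is) ∎
    where
    open ≡-Reasoning
    disjoint : Empty ((edge H i - v) ∩ link v is)
    disjoint (w , w∈∩) =
      let w∈i-v , w∈link      = x∈p∩q⁻ _ _ w∈∩
          i′ , i′∈is , w∈i′-v = ∈-link⁻ is w∈link
          v≡w = ∣p∣≤1⇒x≡y (lin i i′ (All.lookup i∉is i′∈is))
                  (x∈p∩q⁺ (v∈i , All.lookup v∈is i′∈is))
                  (x∈p∩q⁺ (p─q⊆p _ _ w∈i-v , p─q⊆p _ _ w∈i′-v))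
      in x∉p-x (edge H i) (subst (_∈ edge H i - v) (sym v≡w) w∈i-v)

  sum-pred-rank<n : Linear H → ∀ v → sum (map (pred ∘ rank H) (edgesAt v)) < n
  sum-pred-rank<n lin v = begin-strict
    sum (map (pred ∘ rank H) (edgesAt v)) ≡⟨ ∣link∣≡sum-pred-rank lin (edgesAt v) (edgesAt-unique v)
                                                                   (All.all-filter _ (allFin (m H))) ⟨
    ∣ link v (edgesAt v) ∣                <⟨ p⊂q⇒∣p∣<∣q∣ (⊆-max _ , v , ∈⊤ , v∉link (edgesAt v)) ⟩
    ∣ ⊤ {n} ∣                             ≡⟨ ∣⊤∣≡n n ⟩
    n                                     ∎
    where open ≤-Reasoning

  length-filter-2≤rank<n : Linear H → ∀ v → length (filter 2≤rank? (edgesAt v)) < n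
  length-filter-2≤rank<n lin v =
    ≤-trans (s≤s (length-filter≤sum 2≤rank? pred-mono-≤ (edgesAt v))) (sum-pred-rank<n lin v)

  2*deg₃+length-filter-rank≡2<n : Linear H → ∀ v → 2 * deg₃ H v + length (filter rank≡2? (edgesAt v)) < n
  2*deg₃+length-filter-rank≡2<n lin v rewrite deg₃≡length-filter-big v =
    ≤-trans (s≤s (2*length-filter+length-filter≤sum big? rank≡2? pred-mono-≤
                    (λ r≡2 → ≤-reflexive (sym (cong pred r≡2)))
                    (λ 3≤r r≡2 → 1+n≰n (subst (3 ≤_) r≡2 3≤r))
                    (edgesAt v)))
            (sum-pred-rank<n lin v)

  rankTwoEdges : List (Fin (m H))
  rankTwoEdges = filter rank≡2? (allFin (m H))

  rankTwoGraph : SimpleGraph n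
  rankTwoGraph = G , λ k → proj₂ (∈-filter⁻ rank≡2? {xs = allFin (m H)} (∈-lookup k))
    where
    G : Hypergraph n
    G = record
      { m        = length rankTwoEdges
      ; edge     = edge H ∘ lookup rankTwoEdges
      ; distinct = λ {k} {k′} → lookup-injective (filter⁺ _ (allFin⁺ (m H))) k k′ ∘ distinct H
      }

  rankTwoIndex : ∀ i → rank H i ≡ 2 → Fin (length rankTwoEdges)
  rankTwoIndex i r≡2 = Any.index (∈-filter⁺ rank≡2? (∈-allFin i) r≡2)

  lookup-rankTwoIndex : ∀ i r≡2 → i ≡ lookup rankTwoEdges (rankTwoIndex i r≡2)
  lookup-rankTwoIndex i r≡2 = lookup-index (∈-filter⁺ rank≡2? (∈-allFin i) r≡2)

  degree-rankTwoGraph : ∀ v → degree (proj₁ rankTwoGraph) v ≡ length (filter rank≡2? (edgesAt v))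
  degree-rankTwoGraph v = begin
    length (filter (incident? v ∘ lookup ℓ) ks)
      ≡⟨ length-map (lookup ℓ) (filter (incident? v ∘ lookup ℓ) ks) ⟨
    length (map (lookup ℓ) (filter (incident? v ∘ lookup ℓ) ks))
      ≡⟨ cong length (filter-map (incident? v) (lookup ℓ) ks) ⟨
    length (filter (incident? v) (map (lookup ℓ) ks))
      ≡⟨ cong (length ∘ filter (incident? v)) map-lookup-allFin ⟩
    length (filter (incident? v) ℓ)
      ≡⟨ cong length (filter-comm (incident? v) rank≡2? (allFin (m H))) ⟩
    length (filter rank≡2? (edgesAt v))
      ∎
    where
    open ≡-Reasoning
    ℓ  = rankTwoEdges
    ks = allFin (length ℓ)
    map-lookup-allFin : map (lookup ℓ) ks ≡ ℓ
    map-lookup-allFin = trans (map-tabulate id (lookup ℓ)) (tabulate-lookup ℓ)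

-- Extending the coloring to the edges of rank 2 and of rank 1

IsEdgeColoringOn : ∀ {n} (H : Hypergraph n) {C : Set} → Pred (Fin (m H)) 0ℓ → (Fin (m H) → C) → Set
IsEdgeColoringOn H S γ =
  ∀ i j → S i → S j → i ≢ j → γ i ≡ γ j → Disjoint (edge H i) (edge H j)

¬2≤rank⇒rank≤1 : ∀ {n} (H : Hypergraph n) {i} → ¬ 2 ≤ rank H i → rank H i ≤ 1
¬2≤rank⇒rank≤1 H ¬2≤r = ≤-pred (≰⇒> ¬2≤r)

maxDegree≤ : ∀ {N} (G : Hypergraph N) {b} → (∀ v → degree G v ≤ b) → maxDegree G ≤ b
maxDegree≤ {N} G deg≤b =
  foldr-preservesᵇ {P = _≤ _} ⊔-lub z≤n (All.map⁺ {f = degree G} (All.universal deg≤b (allFin N)))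

module _ {n} (H : Hypergraph n) (nonempty : NonemptyEdges H) where

  vertexOf : Fin (m H) → Fin n
  vertexOf i = proj₁ (1≤∣p∣⇒Nonempty {p = edge H i} (nonempty i))

  vertexOf∈ : ∀ i → vertexOf i ∈ edge H i
  vertexOf∈ i = proj₂ (1≤∣p∣⇒Nonempty {p = edge H i} (nonempty i))

ListVizing : Set
ListVizing = ∀ (N : ℕ) (G : SimpleGraph N) → qlist≤ (proj₁ G) (suc (maxDegree (proj₁ G)))

module ColorRankTwo
  (listVizing : ListVizing) {n} (H : Hypergraph n) (lin : Linear H) (nonempty : NonemptyEdges H)
  {d} (regular : ∀ v → deg₃ H v ≡ d)
  (γ₃ : (i : Fin (m H)) → Big H i → Fin n) (γ₃-proper : IsEdgeColoring₃ H γ₃)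
  where

  G : Hypergraph n
  G = proj₁ (rankTwoGraph H)

  -- Any color will do outside E₃; a vertex of the edge is a canonical one.
  γ₃⁺ : Fin (m H) → Fin n
  γ₃⁺ i with big? H i
  ... | yes big = γ₃ i big
  ... | no  _   = vertexOf H nonempty i

  γ₃⁺≡γ₃ : ∀ i big → γ₃⁺ i ≡ γ₃ i big
  γ₃⁺≡γ₃ i big with big? H i
  ... | yes big′ = cong (γ₃ i) (≤-irrelevant big′ big)
  ... | no ¬big  = contradiction big ¬big

  colorsAt : Fin n → List (Fin n)
  colorsAt v = map γ₃⁺ (filter (big? H) (edgesAt H v))

  ∈-colorsAt⁺ : ∀ {v i} big → v ∈ edge H i → γ₃ i big ∈ₗ colorsAt v
  ∈-colorsAt⁺ {v} {i} big v∈i =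
    subst (_∈ₗ colorsAt v) (γ₃⁺≡γ₃ i big) (∈-map⁺ γ₃⁺ (∈-filter⁺ (big? H) (∈-edgesAt⁺ H v∈i) big))

  length-colorsAt : ∀ v → length (colorsAt v) ≡ d
  length-colorsAt v = begin
    length (colorsAt v)                    ≡⟨ length-map γ₃⁺ (filter (big? H) (edgesAt H v)) ⟩
    length (filter (big? H) (edgesAt H v)) ≡⟨ deg₃≡length-filter-big H v ⟨
    deg₃ H v                               ≡⟨ regular v ⟩
    d                                      ∎
    where open ≡-Reasoning

  endpoints : ∀ k → ∃₂ λ u v → ∀ {w} → w ∈ edge G k → w ≡ u ⊎ w ≡ v
  endpoints k = ∣p∣≡2⇒⊆pair (proj₂ (rankTwoGraph H) k)

  forbidden : Fin (m G) → List (Fin n)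
  forbidden k = let u , v , _ = endpoints k in colorsAt u ++ colorsAt v

  length-forbidden : ∀ k → length (forbidden k) ≡ 2 * d
  length-forbidden k = let u , v , _ = endpoints k in begin
    length (colorsAt u ++ colorsAt v)         ≡⟨ length-++ (colorsAt u) ⟩
    length (colorsAt u) + length (colorsAt v) ≡⟨ cong₂ _+_ (length-colorsAt u) (length-colorsAt v) ⟩
    d + d                                     ≡⟨ cong (d +_) (+-identityʳ d) ⟨
    2 * d                                     ∎
    where open ≡-Reasoning

  ∈-forbidden⁺ : ∀ k i big → Nonempty (edge H i ∩ edge G k) → γ₃ i big ∈ₗ forbidden k
  ∈-forbidden⁺ k i big (w , w∈∩) =
    let w∈i , w∈k = x∈p∩q⁻ (edge H i) (edge G k) w∈∩
        u , v , ⊆uv = endpoints k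
    in case ⊆uv w∈k of λ where
         (inj₁ refl) → ∈-++⁺ˡ (∈-colorsAt⁺ big w∈i)
         (inj₂ refl) → ∈-++⁺ʳ (colorsAt u) (∈-colorsAt⁺ big w∈i)

  degree+1+2d≤n : ∀ w → degree G w + suc (2 * d) ≤ n
  degree+1+2d≤n w = begin
    degree G w + suc (2 * d)
      ≡⟨ +-suc (degree G w) (2 * d) ⟩
    suc (degree G w + 2 * d)
      ≡⟨ cong suc (+-comm (degree G w) (2 * d)) ⟩
    suc (2 * d + degree G w)
      ≡⟨ cong₂ (λ x y → suc (2 * x + y)) (regular w) (sym (degree-rankTwoGraph H w)) ⟨
    suc (2 * deg₃ H w + length (filter (rank≡2? H) (edgesAt H w)))
      ≤⟨ 2*deg₃+length-filter-rank≡2<n H lin w ⟩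
    n ∎
    where open ≤-Reasoning

  -- The vertex only witnesses 2d < n, which the truncated subtraction below needs.
  1+Δ+2d≤n : Fin n → suc (maxDegree G) + 2 * d ≤ n
  1+Δ+2d≤n w = begin
    suc (maxDegree G) + 2 * d ≡⟨ +-suc (maxDegree G) (2 * d) ⟨
    maxDegree G + suc (2 * d) ≤⟨ m≤o∸n⇒m+n≤o (maxDegree G) (≤-trans (m≤n+m _ _) (degree+1+2d≤n w)) Δ≤n∸1+2d ⟩
    n                         ∎
    where
    open ≤-Reasoning
    Δ≤n∸1+2d : maxDegree G ≤ n ∸ suc (2 * d)
    Δ≤n∸1+2d = maxDegree≤ G (λ v → m+n≤o⇒m≤o∸n (degree G v) (degree+1+2d≤n v))

  K : ℕ
  K = proj₁ (listVizing n (rankTwoGraph H))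

  K≤1+Δ : K ≤ suc (maxDegree G)
  K≤1+Δ = proj₁ (proj₂ (listVizing n (rankTwoGraph H)))

  choosable : EdgeChoosable G K
  choosable = proj₂ (proj₂ (listVizing n (rankTwoGraph H)))

  K≤length-avoiding : ∀ k → K ≤ length (avoiding (forbidden k))
  K≤length-avoiding k = +-cancelʳ-≤ (2 * d) K _ (begin
    K + 2 * d                           ≤⟨ +-monoˡ-≤ (2 * d) K≤1+Δ ⟩
    suc (maxDegree G) + 2 * d           ≤⟨ 1+Δ+2d≤n (proj₁ (endpoints k)) ⟩
    n                                   ≤⟨ n≤length-avoiding+length (forbidden k) ⟩
    length free + length (forbidden k)  ≡⟨ cong (length free +_) (length-forbidden k) ⟩
    length free + 2 * d                 ∎)
    where
    open ≤-Reasoning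
    free = avoiding (forbidden k)

  lists : Fin (m G) → List ℕ
  lists k = take K (map toℕ (avoiding (forbidden k)))

  length-lists : ∀ k → length (lists k) ≡ K
  length-lists k = trans (length-take K _)
    (m≤n⇒m⊓n≡m (subst (K ≤_) (sym (length-map toℕ (avoiding (forbidden k)))) (K≤length-avoiding k)))

  lists-unique : ∀ k → Unique (lists k)
  lists-unique k = take⁺ K (map⁺ toℕ-injective (avoiding-unique (forbidden k)))

  listColoring : Σ (Fin (m G) → ℕ) λ c → (∀ k → c k ∈ₗ lists k) × IsEdgeColoring G c
  listColoring = choosable lists length-lists lists-unique

  colorOf : ∀ k → ∃ λ c → c ∈ₗ avoiding (forbidden k) × proj₁ listColoring k ≡ toℕ c
  colorOf k = ∈-map⁻ toℕ (∈-take⁻ K _ (proj₁ (proj₂ listColoring) k))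

  color : Fin (m G) → Fin n
  color = proj₁ ∘ colorOf

  color∉forbidden : ∀ k → color k ∉ₗ forbidden k
  color∉forbidden k = ∈-avoiding⇒∉ (proj₁ (proj₂ (colorOf k)))

  color-proper : IsEdgeColoring G color
  color-proper k k′ k≢k′ color≡ = proj₂ (proj₂ listColoring) k k′ k≢k′ (begin
    proj₁ listColoring k  ≡⟨ proj₂ (proj₂ (colorOf k)) ⟩
    toℕ (color k)         ≡⟨ cong toℕ color≡ ⟩
    toℕ (color k′)        ≡⟨ proj₂ (proj₂ (colorOf k′)) ⟨
    proj₁ listColoring k′ ∎)
    where open ≡-Reasoning

  γ₂ : Fin (m H) → Fin n
  γ₂ i with rank≡2? H i
  ... | yes r≡2 = color (rankTwoIndex H i r≡2)
  ... | no  _   = γ₃⁺ i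

  γ₂-extends : ∀ i big → γ₂ i ≡ γ₃ i big
  γ₂-extends i big with rank≡2? H i
  ... | yes r≡2 = contradiction (subst (3 ≤_) r≡2 big) 1+n≰n
  ... | no  _   = γ₃⁺≡γ₃ i big

  rankTwo-proper : ∀ i j ri rj → i ≢ j →
    color (rankTwoIndex H i ri) ≡ color (rankTwoIndex H j rj) → Disjoint (edge H i) (edge H j)
  rankTwo-proper i j ri rj i≢j color≡ =
    color-proper _ _ (i≢j ∘ lookup-cong) color≡ ∘
    subst₂ (λ a b → Nonempty (edge H a ∩ edge H b)) (lookup-rankTwoIndex H i ri) (lookup-rankTwoIndex H j rj)
    where
    lookup-cong : rankTwoIndex H i ri ≡ rankTwoIndex H j rj → i ≡ j
    lookup-cong ki≡kj = begin
      i                                             ≡⟨ lookup-rankTwoIndex H i ri ⟩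
      lookup (rankTwoEdges H) (rankTwoIndex H i ri) ≡⟨ cong (lookup (rankTwoEdges H)) ki≡kj ⟩
      lookup (rankTwoEdges H) (rankTwoIndex H j rj) ≡⟨ lookup-rankTwoIndex H j rj ⟨
      j                                             ∎
      where open ≡-Reasoning

  rankTwo-avoids-big : ∀ i ri j big → Nonempty (edge H j ∩ edge H i) →
                       color (rankTwoIndex H i ri) ≢ γ₃ j big
  rankTwo-avoids-big i ri j big meet color≡ =
    color∉forbidden k (subst (_∈ₗ forbidden k) (sym color≡) (∈-forbidden⁺ k j big meet′))
    where
    k = rankTwoIndex H i ri
    meet′ = subst (λ a → Nonempty (edge H j ∩ edge H a)) (lookup-rankTwoIndex H i ri) meet

  2≤rank∧≢2⇒Big : ∀ {i} → 2 ≤ rank H i → rank H i ≢ 2 → Big H i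
  2≤rank∧≢2⇒Big 2≤r r≢2 = ≤∧≢⇒< 2≤r (r≢2 ∘ sym)

  γ₂-proper : IsEdgeColoringOn H (λ i → 2 ≤ rank H i) γ₂
  γ₂-proper i j 2≤i 2≤j i≢j γ₂≡ meet with rank≡2? H i | rank≡2? H j
  ... | yes ri | yes rj = rankTwo-proper i j ri rj i≢j γ₂≡ meet
  ... | yes ri | no ¬rj =
    rankTwo-avoids-big i ri j (2≤rank∧≢2⇒Big 2≤j ¬rj) (meet-sym meet) (trans γ₂≡ (γ₃⁺≡γ₃ j _))
  ... | no ¬ri | yes rj =
    rankTwo-avoids-big j rj i (2≤rank∧≢2⇒Big 2≤i ¬ri) meet (trans (sym γ₂≡) (γ₃⁺≡γ₃ i _))
  ... | no ¬ri | no ¬rj =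
    γ₃-proper i j (2≤rank∧≢2⇒Big 2≤i ¬ri) (2≤rank∧≢2⇒Big 2≤j ¬rj) i≢j
      (trans (sym (γ₃⁺≡γ₃ i _)) (trans γ₂≡ (γ₃⁺≡γ₃ j _))) meet

module ColorRankOne
  {n} (H : Hypergraph n) (lin : Linear H) (nonempty : NonemptyEdges H)
  (γ₂ : Fin (m H) → Fin n) (γ₂-proper : IsEdgeColoringOn H (λ i → 2 ≤ rank H i) γ₂)
  where

  colorsAt : Fin n → List (Fin n)
  colorsAt v = map γ₂ (filter (2≤rank? H) (edgesAt H v))

  length-colorsAt<n : ∀ v → length (colorsAt v) < n
  length-colorsAt<n v =
    subst (_< n) (sym (length-map γ₂ (filter (2≤rank? H) (edgesAt H v)))) (length-filter-2≤rank<n H lin v)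

  freeAt : Fin n → Fin n
  freeAt v = proj₁ (fresh (colorsAt v) (length-colorsAt<n v))

  freeAt∉colorsAt : ∀ v → freeAt v ∉ₗ colorsAt v
  freeAt∉colorsAt v = proj₂ (fresh (colorsAt v) (length-colorsAt<n v))

  γ : Fin (m H) → Fin n
  γ i with 2≤rank? H i
  ... | yes _ = γ₂ i
  ... | no  _ = freeAt (vertexOf H nonempty i)

  γ-extends : ∀ i → 2 ≤ rank H i → γ i ≡ γ₂ i
  γ-extends i 2≤i with 2≤rank? H i
  ... | yes _    = refl
  ... | no ¬2≤i  = contradiction 2≤i ¬2≤i

  free-avoids : ∀ i j → ¬ 2 ≤ rank H i → 2 ≤ rank H j → Nonempty (edge H i ∩ edge H j) →
                freeAt (vertexOf H nonempty i) ≢ γ₂ j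
  free-avoids i j ¬2≤i 2≤j (w , w∈∩) free≡ =
    let w∈i , w∈j = x∈p∩q⁻ (edge H i) (edge H j) w∈∩
        w≡v       = ∣p∣≤1⇒x≡y (¬2≤rank⇒rank≤1 H ¬2≤i) w∈i (vertexOf∈ H nonempty i)
        j∈        = ∈-filter⁺ (2≤rank? H) (∈-edgesAt⁺ H (subst (_∈ edge H j) w≡v w∈j)) 2≤j
    in freeAt∉colorsAt _ (subst (_∈ₗ colorsAt _) (sym free≡) (∈-map⁺ γ₂ j∈))

  γ-proper : IsEdgeColoring H γ
  γ-proper i j i≢j γ≡ meet@(w , w∈∩) with 2≤rank? H i | 2≤rank? H j
  ... | yes 2≤i | yes 2≤j = γ₂-proper i j 2≤i 2≤j i≢j γ≡ meet
  ... | yes 2≤i | no ¬2≤j = free-avoids j i ¬2≤j 2≤i (meet-sym meet) (sym γ≡)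
  ... | no ¬2≤i | yes 2≤j = free-avoids i j ¬2≤i 2≤j meet γ≡
  ... | no ¬2≤i | no ¬2≤j =
    let w∈i , w∈j = x∈p∩q⁻ (edge H i) (edge H j) w∈∩
    in i≢j (distinct H (trans (∣p∣≤1⇒p≡⁅x⁆ (¬2≤rank⇒rank≤1 H ¬2≤i) w∈i)
                              (sym (∣p∣≤1⇒p≡⁅x⁆ (¬2≤rank⇒rank≤1 H ¬2≤j) w∈j))))

corollary10 : (∀ (N : ℕ) (G : SimpleGraph N) → qlist≤ (proj₁ G) (suc (maxDegree (proj₁ G)))) →
    ∀ (n : ℕ) (H : Hypergraph n) → Linear H → NonemptyEdges H → Regular₃ H →
    (γ₃ : (i : Fin (m H)) → Big H i → Fin n) → IsEdgeColoring₃ H γ₃ →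
    Σ (Fin (m H) → Fin n) λ γ →
    IsEdgeColoring H γ × (∀ i (b : Big H i) → γ i ≡ γ₃ i b)
corollary10 listVizing n H lin nonempty (_ , regular) γ₃ γ₃-proper =
  γ , γ-proper , λ i big → trans (γ-extends i (≤-trans (n≤1+n 2) big)) (γ₂-extends i big)
  where
  open ColorRankTwo listVizing H lin nonempty regular γ₃ γ₃-proper using (γ₂; γ₂-proper; γ₂-extends)
  open ColorRankOne H lin nonempty γ₂ γ₂-proper using (γ; γ-proper; γ-extends)
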